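{- Let $\mathcal{G}$ be an additive subgroup of $\mathbb{R}$, $n$ a positive integer, and $c,m\in\mathcal{G}$ with $c>0$, $m\geq 0$. Suppose $g=(g_0,g_1,\ldots,g_{n-1})\in S$. (a) For each integer $e>0$, $C^{en}(g)\in S$ if and only if $g_0\leq (e+1)c$ and $g_{n-1}>ec$. (b) For all integers $e,p$ with $e\geq 0$ and $0<p<n$, $C^{en+p}(g)\in S$ if and only if $g_p\leq (e+1)c$ and $g_{p-1}>(e+1)c$.
   Context: An area vector is $g=(g_0,\ldots,g_{n-1})\in\mathcal{G}^n$ with $g_{i+1}\leq g_i+m$ for $0\leq i<n-1$; $\mathrm{AV}_n$ is the set of area vectors. The cycling operator $C:\mathcal{G}^n\to\mathcal{G}^n$ is $C(g_0,\ldots,g_{n-1})=(g_1,\ldots,g_{n-1},g_0-c)$, a bijection with powers $C^j$, $j\in\mathbb{Z}$. $S=\{g\in\mathrm{AV}_n: g_0\leq c,\ g_{n-1}>0\}$. -}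

module Defs where

open import Data.Nat using (ℕ; zero; suc)
open import Data.Fin using (Fin)
open import Data.Vec using (Vec; []; _∷_; _∷ʳ_; head; last)
open import Data.Product using (_×_; ∃)
open import Relation.Binary.PropositionalEquality using (_≡_; _≢_)
open import Algebra.Structures using (IsAbelianGroup)
open import Relation.Binary.Structures using (IsTotalOrder)

-- An additive subgroup of ℝ is (by Hölder's theorem) exactly an
-- Archimedean totally ordered abelian group.  ℝ is not available in the
-- standard library, so G is given as such a structure.
-- e-fold sum of x with respect to a given addition and zero
mult : {A : Set} → (A → A → A) → A → ℕ → A → A
mult _+_ z zero    x = z
mult _+_ z (suc e) x = x + mult _+_ z e x

record ArchOrdAbGroup : Set₁ where
  infixl 6 _+_ _-_
  infixr 7 _·_
  infix 4 _≤_ _<_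
  field
    Carrier : Set
    _+_ : Carrier → Carrier → Carrier
    0#  : Carrier
    -_  : Carrier → Carrier
    _≤_ : Carrier → Carrier → Set
    isAbelianGroup : IsAbelianGroup _≡_ _+_ 0# -_
    isTotalOrder   : IsTotalOrder _≡_ _≤_
    +-mono-≤ : ∀ {a b} (x : Carrier) → a ≤ b → a + x ≤ b + x

  _-_ : Carrier → Carrier → Carrier
  a - b = a + (- b)

  _<_ : Carrier → Carrier → Set
  a < b = (a ≤ b) × (a ≢ b)

  _·_ : ℕ → Carrier → Carrier
  e · x = mult _+_ 0# e x

  field
    archimedean : ∀ (a b : Carrier) → 0# < a → ∃ λ (k : ℕ) → b < k · a

module _ (𝔾 : ArchOrdAbGroup) where
  open ArchOrdAbGroup 𝔾

  IsAV : (m : Carrier) → ∀ {n} → Vec Carrier n → Set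
  IsAV m [] = Data.Unit.⊤ where import Data.Unit
  IsAV m (x ∷ []) = Data.Unit.⊤ where import Data.Unit
  IsAV m (x ∷ y ∷ xs) = (y ≤ x + m) × IsAV m (y ∷ xs)

  cyc : (c : Carrier) → ∀ {k} → Vec Carrier (suc k) → Vec Carrier (suc k)
  cyc c (x ∷ xs) = xs ∷ʳ (x - c)

  cycPow : (c : Carrier) → ℕ → ∀ {k} → Vec Carrier (suc k) → Vec Carrier (suc k)
  cycPow c zero    g = g
  cycPow c (suc j) g = cycPow c j (cyc c g)

  InS : (c m : Carrier) → ∀ {k} → Vec Carrier (suc k) → Set
  InS c m g = IsAV m g × (head g ≤ c) × (0# < last g)

{-# OPTIONS --safe #-}
-- Cycling n times subtracts c from every entry, so for 0 ≤ p < n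
--   C^(en+p) g = (g_p - ec, …, g_{n-1} - ec, g_0 - (e+1)c, …, g_{p-1} - (e+1)c),
-- and the two inequalities defining S become conditions on its first and last
-- entries.  Membership in AV_n comes for free: C maps an area vector with
-- g_0 - c ≤ g_{n-1} + m to another one with the same property, and every
-- element of S has it.
module Submission where

open import Defs
open import Data.Nat using (ℕ; suc; _*_) renaming (_+_ to _+ℕ_)
open import Data.Fin using (Fin; inject₁; toℕ)
open import Data.Vec using (Vec; head; last; lookup)
open import Data.Product using (_×_)
open import Function.Bundles using (_⇔_)

open import Data.Nat using (zero)
open import Data.Nat.GeneralisedArithmetic using (fold; iterate)
import Data.Nat.Properties as ℕ
open import Data.Fin using (zero; suc)
open import Data.Vec using ([]; _∷_; _∷ʳ_; toList; tail; initLast; init)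
open import Data.Vec.Properties using (toList-∷ʳ; last-∷ʳ; length-toList)
open import Data.List using (List; []; _∷_; _++_; [_]; map; length)
  renaming (_∷ʳ_ to _∷ʳ′_)
open import Data.List.Properties
  using (++-assoc; ++-identityʳ; map-++; map-id; map-∘; length-map; ∷ʳ-injectiveʳ)
open import Data.Product using (_,_; proj₁; proj₂; ∃₂)
open import Data.Product.Function.NonDependent.Propositional using (_×-⇔_)
open import Data.Unit using (tt)
open import Function.Bundles using (mk⇔; Equivalence)
open import Function.Properties.Equivalence using () renaming (trans to ⇔-trans)
open import Relation.Binary.PropositionalEquality
  using (_≡_; refl; sym; trans; cong; cong₂; subst; subst₂; module ≡-Reasoning)
open import Algebra.Bundles using (AbelianGroup)
open import Algebra.Structures using (IsAbelianGroup)
open import Relation.Binary.Structures using (IsTotalOrder)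
import Algebra.Properties.AbelianGroup as AbelianGroupProperties
import Algebra.Properties.CommutativeSemigroup as CommutativeSemigroupProperties

private
  variable
    A : Set
    n : ℕ

iterate-+ : ∀ (f : A → A) x m n → iterate f x (m +ℕ n) ≡ iterate f (iterate f x m) n
iterate-+ f x zero    n = refl
iterate-+ f x (suc m) n = iterate-+ f (f x) m n

toList-head : (v : Vec A (suc n)) → toList v ≡ head v ∷ toList (tail v)
toList-head (x ∷ v) = refl

toList-init-last : (v : Vec A (suc n)) → toList v ≡ toList (init v) ∷ʳ′ last v
toList-init-last v with initLast v
... | xs , x , refl = toList-∷ʳ x xs

head-toList : (v : Vec A (suc n)) {x : A} {xs : List A} → toList v ≡ x ∷ xs → head v ≡ x
head-toList (y ∷ v) refl = refl

last-toList : (v : Vec A (suc n)) {x : A} (xs : List A) → toList v ≡ xs ∷ʳ′ x → last v ≡ x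
last-toList v xs eq = ∷ʳ-injectiveʳ (toList (init v)) xs (trans (sym (toList-init-last v)) eq)

toList-split-at-lookup : (v : Vec A (suc n)) (q : Fin n) → ∃₂ λ xs ys →
  length xs ≡ toℕ q × toList v ≡ xs ++ lookup v (inject₁ q) ∷ lookup v (suc q) ∷ ys
toList-split-at-lookup (x ∷ y ∷ ys) zero = [] , toList ys , refl , refl
toList-split-at-lookup (x ∷ v) (suc q) with toList-split-at-lookup v q
... | xs , ys , len , eq = x ∷ xs , ys , cong suc len , cong (x ∷_) eq

-- C acts on toList v as rotate (_- c); on lists no casts between Vec (p + q) and Vec (q + p) arise.
module Rotation (f : A → A) where

  f^_ : ℕ → A → A
  (f^ e) x = fold x f e

  rotate : List A → List A
  rotate []       = []
  rotate (x ∷ xs) = xs ++ [ f x ]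

  iterate-rotate-++ : ∀ xs ys → iterate rotate (xs ++ ys) (length xs) ≡ ys ++ map f xs
  iterate-rotate-++ []       ys = sym (++-identityʳ ys)
  iterate-rotate-++ (x ∷ xs) ys = begin
    iterate rotate ((xs ++ ys) ++ [ f x ]) (length xs)
      ≡⟨ cong (λ l → iterate rotate l (length xs)) (++-assoc xs ys [ f x ]) ⟩
    iterate rotate (xs ++ ys ++ [ f x ]) (length xs)
      ≡⟨ iterate-rotate-++ xs (ys ++ [ f x ]) ⟩
    (ys ++ [ f x ]) ++ map f xs
      ≡⟨ ++-assoc ys [ f x ] (map f xs) ⟩
    ys ++ map f (x ∷ xs) ∎
    where open ≡-Reasoning

  iterate-rotate-length : ∀ xs → iterate rotate xs (length xs) ≡ map f xs
  iterate-rotate-length xs =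
    trans (cong (λ l → iterate rotate l (length xs)) (sym (++-identityʳ xs)))
          (iterate-rotate-++ xs [])

  iterate-rotate-suc-++ : ∀ xs x ys →
    iterate rotate (xs ++ x ∷ ys) (suc (length xs)) ≡ (ys ++ map f xs) ∷ʳ′ f x
  iterate-rotate-suc-++ xs x ys = begin
    iterate rotate (xs ++ x ∷ ys) (suc (length xs))
      ≡⟨ cong (iterate rotate (xs ++ x ∷ ys)) (ℕ.+-comm 1 (length xs)) ⟩
    iterate rotate (xs ++ x ∷ ys) (length xs +ℕ 1)
      ≡⟨ iterate-+ rotate (xs ++ x ∷ ys) (length xs) 1 ⟩
    rotate (iterate rotate (xs ++ x ∷ ys) (length xs))
      ≡⟨ cong rotate (iterate-rotate-++ xs (x ∷ ys)) ⟩
    (ys ++ map f xs) ∷ʳ′ f x ∎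
    where open ≡-Reasoning

  iterate-rotate-*length : ∀ e xs →
    iterate rotate xs (e * length xs) ≡ map (f^ e) xs
  iterate-rotate-*length zero    xs = sym (map-id xs)
  iterate-rotate-*length (suc e) xs = begin
    iterate rotate xs (length xs +ℕ e * length xs)
      ≡⟨ cong (iterate rotate xs) (ℕ.+-comm (length xs) (e * length xs)) ⟩
    iterate rotate xs (e * length xs +ℕ length xs)
      ≡⟨ iterate-+ rotate xs (e * length xs) (length xs) ⟩
    iterate rotate (iterate rotate xs (e * length xs)) (length xs)
      ≡⟨ cong (λ l → iterate rotate l (length xs)) (iterate-rotate-*length e xs) ⟩
    iterate rotate (map fᵉ xs) (length xs)
      ≡⟨ cong (iterate rotate (map fᵉ xs)) (sym (length-map fᵉ xs)) ⟩
    iterate rotate (map fᵉ xs) (length (map fᵉ xs))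
      ≡⟨ iterate-rotate-length (map fᵉ xs) ⟩
    map f (map fᵉ xs)
      ≡⟨ map-∘ xs ⟨
    map (f^ suc e) xs ∎
    where
      open ≡-Reasoning
      fᵉ : A → A
      fᵉ = f^ e

  iterate-rotate-*length-+ : ∀ e xs a b ys → let l = xs ++ a ∷ b ∷ ys in
    iterate rotate l (e * length l +ℕ suc (length xs))
      ≡ ((f^ e) b ∷ map (f^ e) ys ++ map f (map (f^ e) xs)) ∷ʳ′ (f^ suc e) a
  iterate-rotate-*length-+ e xs a b ys = begin
    iterate rotate l (e * length l +ℕ suc (length xs))
      ≡⟨ iterate-+ rotate l (e * length l) (suc (length xs)) ⟩
    iterate rotate (iterate rotate l (e * length l)) (suc (length xs))
      ≡⟨ cong (λ l′ → iterate rotate l′ (suc (length xs))) (iterate-rotate-*length e l) ⟩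
    iterate rotate (map fᵉ l) (suc (length xs))
      ≡⟨ cong₂ (λ l′ p → iterate rotate l′ (suc p)) (map-++ fᵉ xs (a ∷ b ∷ ys)) (sym (length-map fᵉ xs)) ⟩
    iterate rotate (map fᵉ xs ++ fᵉ a ∷ fᵉ b ∷ map fᵉ ys) (suc (length (map fᵉ xs)))
      ≡⟨ iterate-rotate-suc-++ (map fᵉ xs) (fᵉ a) (fᵉ b ∷ map fᵉ ys) ⟩
    (fᵉ b ∷ map fᵉ ys ++ map f (map fᵉ xs)) ∷ʳ′ f (fᵉ a) ∎
    where
      open ≡-Reasoning
      fᵉ : A → A
      fᵉ = f^ e
      l : List A
      l = xs ++ a ∷ b ∷ ys

module OrderedGroupProperties (𝔾 : ArchOrdAbGroup) where
  open ArchOrdAbGroup 𝔾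
  open IsAbelianGroup isAbelianGroup using (identityˡ; identityʳ; inverseʳ; assoc; comm)

  abelianGroup : AbelianGroup _ _
  abelianGroup = record { isAbelianGroup = isAbelianGroup }

  open AbelianGroup abelianGroup using (commutativeSemigroup)
  open AbelianGroupProperties abelianGroup
    using (//-rightDividesˡ; //-rightDividesʳ; ∙-cancelʳ; ε⁻¹≈ε; ⁻¹-anti-homo-∙)
  open CommutativeSemigroupProperties commutativeSemigroup using (xy∙z≈xz∙y)

  +-mono-< : ∀ {a b} x → a < b → a + x < b + x
  +-mono-< x (a≤b , a≢b) = +-mono-≤ x a≤b , λ eq → a≢b (∙-cancelʳ x _ _ eq)

  x-d≤y⇔x≤y+d : ∀ x d y → (x - d ≤ y) ⇔ (x ≤ y + d)
  x-d≤y⇔x≤y+d x d y = mk⇔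
    (λ h → subst (_≤ y + d) (//-rightDividesˡ d x) (+-mono-≤ d h))
    (λ h → subst (x - d ≤_) (//-rightDividesʳ d y) (+-mono-≤ (- d) h))

  0<x-d⇔d<x : ∀ x d → (0# < x - d) ⇔ (d < x)
  0<x-d⇔d<x x d = mk⇔
    (λ h → subst₂ _<_ (identityˡ d) (//-rightDividesˡ d x) (+-mono-< d h))
    (λ h → subst (_< x - d) (inverseʳ d) (+-mono-< (- d) h))

  x≤x+m : ∀ {m} x → 0# ≤ m → x ≤ x + m
  x≤x+m {m} x 0≤m = subst₂ _≤_ (identityˡ x) (comm m x) (+-mono-≤ x 0≤m)

  x-c≤x : ∀ {c} x → 0# ≤ c → x - c ≤ x
  x-c≤x {c} x 0≤c = Equivalence.from (x-d≤y⇔x≤y+d x c x) (x≤x+m x 0≤c)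

  x+m-c≡x-c+m : ∀ x m c → x + m - c ≡ x - c + m
  x+m-c≡x-c+m x m c = xy∙z≈xz∙y x m (- c)

  fold-sub : ∀ c e x → fold x (_- c) e ≡ x - e · c
  fold-sub c zero    x = sym (trans (cong (x +_) ε⁻¹≈ε) (identityʳ x))
  fold-sub c (suc e) x = begin
    fold x (_- c) e - c    ≡⟨ cong (_- c) (fold-sub c e x) ⟩
    x - e · c - c          ≡⟨ assoc x (- (e · c)) (- c) ⟩
    x + (- (e · c) - c)    ≡⟨ cong (x +_) (⁻¹-anti-homo-∙ c (e · c)) ⟨
    x - suc e · c          ∎
    where open ≡-Reasoning

module Cycling (𝔾 : ArchOrdAbGroup) (c : ArchOrdAbGroup.Carrier 𝔾) where
  open ArchOrdAbGroup 𝔾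
  open OrderedGroupProperties 𝔾
  open IsAbelianGroup isAbelianGroup using (inverseʳ)
  open Rotation (_- c)
  open IsTotalOrder isTotalOrder using () renaming (trans to ≤-trans)

  toList-cycPow : ∀ j (v : Vec Carrier (suc n)) →
    toList (cycPow 𝔾 c j v) ≡ iterate rotate (toList v) j
  toList-cycPow zero    v        = refl
  toList-cycPow (suc j) (x ∷ xs) =
    trans (toList-cycPow j (xs ∷ʳ (x - c)))
          (cong (λ l → iterate rotate l j) (toList-∷ʳ (x - c) xs))

  toList-cycPow-* : ∀ e (v : Vec Carrier (suc n)) →
    toList (cycPow 𝔾 c (e * suc n) v) ≡ map (f^ e) (toList v)
  toList-cycPow-* {n} e v = begin
    toList (cycPow 𝔾 c (e * suc n) v)
      ≡⟨ toList-cycPow (e * suc n) v ⟩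
    iterate rotate (toList v) (e * suc n)
      ≡⟨ cong (λ p → iterate rotate (toList v) (e * p)) (sym (length-toList v)) ⟩
    iterate rotate (toList v) (e * length (toList v))
      ≡⟨ iterate-rotate-*length e (toList v) ⟩
    map (f^ e) (toList v) ∎
    where open ≡-Reasoning

  cycPow-*-ends : ∀ e (v : Vec Carrier (suc n)) →
    let w = cycPow 𝔾 c (e * suc n) v in
    head w ≡ head v - e · c × last w ≡ last v - e · c
  cycPow-*-ends {n} e v =
    trans (head-toList w toList-w-head) (fold-sub c e (head v)) ,
    trans (last-toList w (map (f^ e) (toList (init v))) toList-w-last) (fold-sub c e (last v))
    where
      w : Vec Carrier (suc n)
      w = cycPow 𝔾 c (e * suc n) v
      toList-w-head : toList w ≡ (f^ e) (head v) ∷ map (f^ e) (toList (tail v))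
      toList-w-head = trans (toList-cycPow-* e v) (cong (map (f^ e)) (toList-head v))
      toList-w-last : toList w ≡ map (f^ e) (toList (init v)) ∷ʳ′ (f^ e) (last v)
      toList-w-last = trans (toList-cycPow-* e v)
                            (trans (cong (map (f^ e)) (toList-init-last v))
                                   (map-++ (f^ e) (toList (init v)) [ last v ]))

  cycPow-*-+-ends : ∀ e (v : Vec Carrier (suc n)) (q : Fin n) →
    let w = cycPow 𝔾 c (e * suc n +ℕ suc (toℕ q)) v in
    head w ≡ lookup v (suc q) - e · c × last w ≡ lookup v (inject₁ q) - suc e · c
  cycPow-*-+-ends {n} e v q with toList-split-at-lookup v q
  ... | xs , ys , len , eq =
    trans (head-toList w toList-w) (fold-sub c e b) ,
    trans (last-toList w front toList-w) (fold-sub c (suc e) a)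
    where
      open ≡-Reasoning
      a b : Carrier
      a = lookup v (inject₁ q)
      b = lookup v (suc q)
      j : ℕ
      j = e * suc n +ℕ suc (toℕ q)
      w : Vec Carrier (suc n)
      w = cycPow 𝔾 c j v
      front : List Carrier
      front = (f^ e) b ∷ map (f^ e) ys ++ map (_- c) (map (f^ e) xs)
      toList-w : toList w ≡ front ∷ʳ′ (f^ suc e) a
      toList-w = begin
        toList w
          ≡⟨ toList-cycPow j v ⟩
        iterate rotate (toList v) j
          ≡⟨ cong₂ (λ p r → iterate rotate (toList v) (e * p +ℕ suc r)) (sym (length-toList v)) (sym len) ⟩
        iterate rotate (toList v) (e * length (toList v) +ℕ suc (length xs))
          ≡⟨ cong (λ l → iterate rotate l (e * length l +ℕ suc (length xs))) eq ⟩
        iterate rotate (xs ++ a ∷ b ∷ ys) (e * length (xs ++ a ∷ b ∷ ys) +ℕ suc (length xs))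
          ≡⟨ iterate-rotate-*length-+ e xs a b ys ⟩
        front ∷ʳ′ (f^ suc e) a ∎

  module _ (m : Carrier) where

    -- The last AV inequality of (g_0, …, g_{n-1}, g_0 - c): under it C preserves AV_n.
    WrapsAround : Vec Carrier (suc n) → Set
    WrapsAround v = head v - c ≤ last v + m

    IsAV-∷ʳ : ∀ (v : Vec Carrier (suc n)) {y} → IsAV 𝔾 m v → y ≤ last v + m → IsAV 𝔾 m (v ∷ʳ y)
    IsAV-∷ʳ (x ∷ [])     _          y≤ = y≤ , tt
    IsAV-∷ʳ (x ∷ z ∷ zs) (z≤ , av) y≤ = z≤ , IsAV-∷ʳ (z ∷ zs) av y≤

    cyc-preserves : 0# ≤ c → 0# ≤ m → (v : Vec Carrier (suc n)) →
      IsAV 𝔾 m v → WrapsAround v → IsAV 𝔾 m (cyc 𝔾 c v) × WrapsAround (cyc 𝔾 c v)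
    cyc-preserves 0≤c 0≤m (x ∷ [])     _          _ = tt , ≤-trans (x-c≤x (x - c) 0≤c) (x≤x+m (x - c) 0≤m)
    cyc-preserves 0≤c 0≤m (x ∷ y ∷ ys) (y≤ , av) w =
      IsAV-∷ʳ (y ∷ ys) av w ,
      subst (λ z → y - c ≤ z + m) (sym (last-∷ʳ (x - c) ys))
            (subst (y - c ≤_) (x+m-c≡x-c+m x m c) (+-mono-≤ (- c) y≤))

    cycPow-preserves-IsAV : 0# ≤ c → 0# ≤ m → ∀ j (v : Vec Carrier (suc n)) →
      IsAV 𝔾 m v → WrapsAround v → IsAV 𝔾 m (cycPow 𝔾 c j v)
    cycPow-preserves-IsAV 0≤c 0≤m zero    v av _ = av
    cycPow-preserves-IsAV 0≤c 0≤m (suc j) v av w =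
      let av′ , w′ = cyc-preserves 0≤c 0≤m v av w
      in cycPow-preserves-IsAV 0≤c 0≤m j (cyc 𝔾 c v) av′ w′

    InS⇒WrapsAround : 0# ≤ m → (v : Vec Carrier (suc n)) → InS 𝔾 c m v → WrapsAround v
    InS⇒WrapsAround 0≤m v (_ , head≤c , 0<last) =
      ≤-trans (subst (head v - c ≤_) (inverseʳ c) (+-mono-≤ (- c) head≤c))
              (≤-trans (proj₁ 0<last) (x≤x+m (last v) 0≤m))

    InS⇔ : ∀ {v : Vec Carrier (suc n)} {x d y d′} → IsAV 𝔾 m v →
      head v ≡ x - d × last v ≡ y - d′ → InS 𝔾 c m v ⇔ (x ≤ c + d × d′ < y)
    InS⇔ {x = x} {d} {y} {d′} av (head≡ , last≡) =
      ⇔-trans (mk⇔ proj₂ (av ,_))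
              (subst (λ z → (z ≤ c) ⇔ (x ≤ c + d)) (sym head≡) (x-d≤y⇔x≤y+d x d c)
               ×-⇔ subst (λ z → (0# < z) ⇔ (d′ < y)) (sym last≡) (0<x-d⇔d<x y d′))

lemma2p15 : (𝔾 : ArchOrdAbGroup) → let open ArchOrdAbGroup 𝔾 in
  (c m : Carrier) → 0# < c → 0# ≤ m →
  (k : ℕ) → (g : Vec Carrier (suc k)) → InS 𝔾 c m g →
  ((e : ℕ) → Data.Nat._<_ 0 e →
    (InS 𝔾 c m (cycPow 𝔾 c (e * suc k) g)
      ⇔ ((head g ≤ suc e · c) × (e · c < last g))))
  ×
  ((e : ℕ) → (q : Fin k) →
    (InS 𝔾 c m (cycPow 𝔾 c (e * suc k +ℕ suc (toℕ q)) g)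
      ⇔ ((lookup g (Fin.suc q) ≤ suc e · c) × (suc e · c < lookup g (inject₁ q)))))
lemma2p15 𝔾 c m 0<c 0≤m k g g∈S =
  -- the hypothesis 0 < e is unnecessary: the equivalence holds for every e
  (λ e _ → InS⇔ m (isAV (e * suc k)) (cycPow-*-ends e g)) ,
  (λ e q → InS⇔ m (isAV (e * suc k +ℕ suc (toℕ q))) (cycPow-*-+-ends e g q))
  where
    open Cycling 𝔾 c
    isAV : ∀ j → IsAV 𝔾 m (cycPow 𝔾 c j g)
    isAV j = cycPow-preserves-IsAV m (proj₁ 0<c) 0≤m j g (proj₁ g∈S) (InS⇒WrapsAround m 0≤m g g∈S)
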